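{- Let $m\ge 2$ be an integer. Let $A, C\ge 1$ and $B$ be integers with $0\le B<A$ such that $p(An+B)\equiv 0 \pmod{C}$ for all integers $n\ge 0$, where $p(n)$ is the number of partitions of $n$. If $A \mid m$, then for every integer $n\ge 0$ and every integer $k\ge 1$, $$o_{\rho,m}(An+B,k)\equiv 0 \pmod{C}.$$
   Context: Fix an integer $m\ge 2$. Every positive integer $N$ can be written uniquely as $N=j m^k$ with $k\ge 0$ and $m\nmid j$. For a partition $\lambda$, let $f_N$ be the number of times the part $N$ appears, and write its base-$m$ expansion $f_N=\sum_{\ell\ge 0} a_{N,\ell}\, m^\ell$ with digits $a_{N,\ell}\in\{0,1,\dots,m-1\}$. For each positive integer $j$ with $m\nmid j$, the part-frequency matrix $M_j$ of $\lambda$ (with modulus $m$) is the infinite matrix with rows and columns indexed by $0,1,2,\dots$ whose entry in row $k$, column $\ell$ is $a_{jm^k,\ell}$. The sequence $(M_j)_{m\nmid j}$ determines $\lambda$, and $|\lambda|=\sum_{j}\sum_{k,\ell} (M_j)_{k,\ell}\, j\, m^{k+\ell}$. The entries $(k,\ell)$ with $k+\ell=d$ form the $d$-th antidiagonal. The map $\rho$ (with modulus $m$) sends $\lambda$ to the partition whose matrices $M'_j$ are given by $(M'_j)_{k,\ell}=(M_j)_{k-1,\ell+1}$ for $k\ge 1$ and $(M'_j)_{0,\ell}=(M_j)_{\ell,0}$; i.e. each entry moves one place down and one place left within its antidiagonal, and the lowest entry of each antidiagonal moves to its upper end. This is a weight-preserving bijection on partitions of $n$, so it partitions the set of partitions of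 $n$ into finite orbits $\{\rho^t(\lambda): t\ge 0\}$. $o_{\rho,m}(n,k)$ denotes the number of distinct orbits of size $k$ among the partitions of $n$. -}

module Defs where

open import Data.Nat using (ℕ; zero; suc; _+_; _*_; _^_; _≤_; _<_; _≤?_; _≟_; NonZero)
open import Data.Nat.DivMod using (_/_; _%_)
open import Data.Nat.Properties using (m^n≢0)
open import Data.Fin using (Fin; toℕ; fromℕ<)
open import Data.Vec using (Vec; []; _∷_; lookup; tabulate)
import Data.Vec.Properties as VecP
open import Data.List using (List; []; _∷_; map; concatMap; upTo; length; filter)
open import Data.Nat.ListAction using (sum)
open import Data.List.Relation.Unary.Any using (any?)
open import Relation.Nullary using (Dec; yes; no)
open import Relation.Binary.PropositionalEquality using (_≡_)

-- Partitions of n, by part frequencies.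
-- A partition of n is represented by  v : Vec ℕ n , where the entry at
-- index i is the frequency f_{i+1} of the part i+1 (parts are ≤ n).

vecs : (b len : ℕ) → List (Vec ℕ len)
vecs b zero = [] ∷ []
vecs b (suc len) = concatMap (λ x → map (x ∷_) (vecs b len)) (upTo (suc b))

freq : ∀ {n} → Vec ℕ n → ℕ → ℕ
freq v zero = 0
freq {n} v (suc N) with suc N ≤? n
... | yes p = lookup v (fromℕ< p)
... | no _ = 0

weight : ∀ {n} → Vec ℕ n → ℕ
weight {n} v = sum (map (λ N → N * freq v N) (upTo (suc n)))

partitions : (n : ℕ) → List (Vec ℕ n)
partitions n = filter (λ v → weight v ≟ n) (vecs n n)

p : ℕ → ℕ
p n = length (partitions n)

module _ (m : ℕ) .{{_ : NonZero m}} where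

  val : ℕ → ℕ → ℕ
  val zero N = 0
  val (suc fuel) N with N % m
  ... | zero = suc (val fuel (N / m))
  ... | suc _ = 0

  -- N = jOf N * m ^ kOf N with m ∤ jOf N  (for N ≥ 1)
  kOf : ℕ → ℕ
  kOf N = val N N

  jOf : ℕ → ℕ
  jOf N = _/_ N (m ^ kOf N) {{m^n≢0 m (kOf N)}}

  digit : (ℕ → ℕ) → ℕ → ℕ → ℕ
  digit f N ℓ = (_/_ (f N) (m ^ ℓ) {{m^n≢0 m ℓ}}) % m

  matrix : (ℕ → ℕ) → ℕ → ℕ → ℕ → ℕ
  matrix f j k ℓ = digit f (j * m ^ k) ℓ

  matrix′ : (ℕ → ℕ) → ℕ → ℕ → ℕ → ℕ
  matrix′ f j zero ℓ = matrix f j ℓ 0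
  matrix′ f j (suc k) ℓ = matrix f j k (suc ℓ)

  freq′ : ℕ → (ℕ → ℕ) → ℕ → ℕ
  freq′ L f N = sum (map (λ ℓ → matrix′ f (jOf N) (kOf N) ℓ * m ^ ℓ) (upTo L))

  -- ρ on partitions of n (all digits beyond position n vanish, and
  -- ρ(λ) has no part larger than n since it preserves weight)
  ρ : ∀ {n} → Vec ℕ n → Vec ℕ n
  ρ {n} v = tabulate (λ i → freq′ (suc n) (freq v) (suc (toℕ i)))

  ρ^ : ∀ {n} → ℕ → Vec ℕ n → Vec ℕ n
  ρ^ zero v = v
  ρ^ (suc t) v = ρ (ρ^ t v)

  _≟v_ : ∀ {n} (u v : Vec ℕ n) → Dec (u ≡ v)
  _≟v_ = VecP.≡-dec _≟_

  -- size of the orbit of v: least t ≥ 1 with ρ^t v = v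
  -- (searched among 1 ≤ t ≤ p(n), which suffices since ρ permutes the
  --  p(n) partitions of n)
  firstReturn : ∀ {n} → Vec ℕ n → List ℕ → ℕ
  firstReturn v [] = 0
  firstReturn v (t ∷ ts) with ρ^ t v ≟v v
  ... | yes _ = t
  ... | no _ = firstReturn v ts

  orbitSize : ∀ {n} → Vec ℕ n → ℕ
  orbitSize {n} v = firstReturn v (map suc (upTo (p n)))

  InOrbit : ∀ {n} → Vec ℕ n → Vec ℕ n → Set
  InOrbit {n} u v = Data.List.Relation.Unary.Any.Any (λ t → ρ^ t v ≡ u) (upTo (orbitSize v))

  inOrbit? : ∀ {n} (u v : Vec ℕ n) → Dec (InOrbit u v)
  inOrbit? u v = any? (λ t → ρ^ t v ≟v u) (upTo (orbitSize v))

  reps : ∀ {n} → List (Vec ℕ n) → List (Vec ℕ n) → List (Vec ℕ n)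
  reps seen [] = []
  reps seen (x ∷ xs) with any? (λ y → inOrbit? y x) seen
  ... | yes _ = reps (x ∷ seen) xs
  ... | no _ = x ∷ reps (x ∷ seen) xs

  o : ℕ → ℕ → ℕ
  o n k = length (filter (λ v → orbitSize v ≟ k) (reps [] (partitions n)))

module Submission where

-- Split each partition λ as η ⊕ ν, where ν keeps, for every part N prime to m, the units digit
-- of its frequency f_N, and η is the rest.  These digits are the (0,0) entries of the matrices
-- M_j, each alone on its antidiagonal, and η has none of them, so ρ^t λ = ρ^t η ⊕ ν.  Hence λ and
-- η have the same orbit size, and the orbits among partitions of n correspond to the pairs
-- (orbit of η, ν) with |η| + |ν| = n.  Every |η| is divisible by m, hence by A.  Let μ(y) count
-- the possible ν of weight y; then p(y) = Σ_η μ(y − |η|), whose η = ∅ term is μ(y) while every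
-- other y − |η| is smaller and ≡ B (mod A), so induction gives C ∣ μ(An + B).  Finally
-- o(An + B, k) = Σ μ(An + B − |η|) over lex-least representatives η of the orbits of size k.

open import Defs
open import Data.Nat using (ℕ; zero; suc; _+_; _*_; _∸_; _^_; _≤_; _<_; _≟_; _<?_; _≤?_; z≤n; s≤s; NonZero; >-nonZero⁻¹)
open import Data.Nat.Properties
open import Data.Nat.DivMod
open import Data.Nat.Divisibility using (_∣_; divides; _∣0; ∣-trans; ∣m∣n⇒∣m+n; ∣m+n∣m⇒∣n; m%n≡0⇒n∣m; n∣m*n; m∣m*n)
open import Data.Nat.Induction using (<-rec)
open import Data.Nat.ListAction using (sum)
open import Data.Nat.ListAction.Properties using (sum-++)
open import Data.Fin using (toℕ; fromℕ<)
import Data.Fin as Fin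
open import Data.Fin.Properties using (toℕ<n; fromℕ<-toℕ; toℕ-fromℕ<)
open import Data.Vec using (Vec; []; _∷_; lookup; tabulate; zipWith; replicate)
open import Data.Vec.Properties using (lookup-zipWith; lookup∘tabulate; tabulate∘lookup; tabulate-cong; lookup-replicate; ≡-dec)
import Data.Vec.Relation.Binary.Lex.Strict as Lex
open import Data.Vec.Relation.Binary.Lex.Core using (this; next)
open import Data.Vec.Relation.Binary.Pointwise.Inductive using (Pointwise-≡⇒≡; ≡⇒Pointwise-≡)
open import Data.List using (List; []; _∷_; map; upTo; applyUpTo; length; filter; _++_)
open import Data.List.Properties using (length-map; length-++; map-cong; map-++; upTo-∷ʳ; filter-none; filter-accept; filter-reject)
open import Data.List.Relation.Unary.Any as Any using (Any; here; there)
open import Data.List.Relation.Unary.All as All using (All; []; _∷_)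
import Data.List.Relation.Unary.All.Properties as All
open import Data.List.Relation.Unary.AllPairs as AllPairs using (AllPairs; []; _∷_)
import Data.List.Relation.Unary.AllPairs.Properties as AllPairs
open import Data.List.Relation.Unary.Unique.Propositional using (Unique)
import Data.List.Relation.Unary.Unique.Propositional.Properties as Unique
open import Data.List.Membership.Propositional using (_∈_; lose; find)
open import Data.List.Membership.Propositional.Properties using (∈-map⁺; ∈-map⁻; ∈-∃++; ∈-upTo⁺; ∈-concatMap⁺; ∈-applyUpTo⁻; ∈-filter⁺; ∈-filter⁻)
open import Data.List.Relation.Binary.Subset.Propositional using (_⊆_)
open import Data.Product using (∃; _×_; _,_; proj₁; proj₂)
open import Data.Sum using (_⊎_; inj₁; inj₂)
open import Data.Empty using (⊥-elim)
open import Function using (_∘_)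
open import Relation.Nullary using (Dec; yes; no; ¬_)
open import Relation.Nullary.Decidable using (¬?; _×-dec_)
open import Relation.Binary.Definitions using (DecidableEquality; tri<; tri≈; tri>)
open import Relation.Binary.PropositionalEquality
open import Algebra.Properties.CommutativeSemigroup +-commutativeSemigroup using (interchange)

module _ {A : Set} where

  sum-map-+ : (g h : A → ℕ) (xs : List A) →
              sum (map (λ x → g x + h x) xs) ≡ sum (map g xs) + sum (map h xs)
  sum-map-+ g h [] = refl
  sum-map-+ g h (x ∷ xs) =
    trans (cong (g x + h x +_) (sum-map-+ g h xs)) (interchange (g x) (h x) _ _)

  sum-map-cong : (g h : A → ℕ) (xs : List A) → (∀ x → x ∈ xs → g x ≡ h x) →
                 sum (map g xs) ≡ sum (map h xs)
  sum-map-cong g h [] e = refl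
  sum-map-cong g h (x ∷ xs) e = cong₂ _+_ (e x (here refl)) (sum-map-cong g h xs (λ y y∈ → e y (there y∈)))

  ≤-sum-map : (g : A → ℕ) {x : A} {xs : List A} → x ∈ xs → g x ≤ sum (map g xs)
  ≤-sum-map g (here refl) = m≤m+n _ _
  ≤-sum-map g {xs = y ∷ ys} (there x∈) = ≤-trans (≤-sum-map g x∈) (m≤n+m _ (g y))

  ∣-sum-map : {C : ℕ} (g : A → ℕ) (xs : List A) → (∀ x → x ∈ xs → C ∣ g x) → C ∣ sum (map g xs)
  ∣-sum-map g [] e = divides 0 refl
  ∣-sum-map g (x ∷ xs) e = ∣m∣n⇒∣m+n (e x (here refl)) (∣-sum-map g xs (λ y y∈ → e y (there y∈)))

  ∣-sum-map⇒∣ : {C : ℕ} (g : A → ℕ) {z : A} {xs : List A} → Unique xs → z ∈ xs →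
                (∀ x → x ∈ xs → x ≢ z → C ∣ g x) → C ∣ sum (map g xs) → C ∣ g z
  ∣-sum-map⇒∣ {C} g {xs = x ∷ xs} (x∉xs ∷ _) (here refl) e d =
    ∣m+n∣m⇒∣n (subst (C ∣_) (+-comm (g x) _) d)
      (∣-sum-map g xs (λ y y∈ → e y (there y∈) (λ y≡x → All.lookup x∉xs y∈ (sym y≡x))))
  ∣-sum-map⇒∣ g {xs = x ∷ xs} (x∉xs ∷ u) (there z∈) e d =
    ∣-sum-map⇒∣ g u z∈ (λ y y∈ → e y (there y∈)) (∣m+n∣m⇒∣n d (e x (here refl) (All.lookup x∉xs z∈)))

  ∈-++-∷⁻ : {w z : A} (ys zs : List A) → w ∈ ys ++ z ∷ zs → w ≢ z → w ∈ ys ++ zs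
  ∈-++-∷⁻ [] zs (here refl) w≢z = ⊥-elim (w≢z refl)
  ∈-++-∷⁻ [] zs (there w∈) w≢z = w∈
  ∈-++-∷⁻ (y ∷ ys) zs (here refl) w≢z = here refl
  ∈-++-∷⁻ (y ∷ ys) zs (there w∈) w≢z = there (∈-++-∷⁻ ys zs w∈ w≢z)

  Unique-⊆⇒length≤ : {xs ys : List A} → Unique xs → xs ⊆ ys → length xs ≤ length ys
  Unique-⊆⇒length≤ {[]} u s = z≤n
  Unique-⊆⇒length≤ {x ∷ xs} (x∉xs ∷ u) s with ∈-∃++ (s (here refl))
  ... | ys₁ , ys₂ , refl = begin
    suc (length xs)           ≤⟨ s≤s (Unique-⊆⇒length≤ u xs⊆ys₁ys₂) ⟩
    suc (length (ys₁ ++ ys₂)) ≡⟨ cong suc (length-++ ys₁) ⟩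
    suc (length ys₁ + length ys₂) ≡⟨ +-suc (length ys₁) _ ⟨
    length ys₁ + length (x ∷ ys₂) ≡⟨ length-++ ys₁ ⟨
    length (ys₁ ++ x ∷ ys₂)   ∎
    where
    open ≤-Reasoning
    xs⊆ys₁ys₂ : xs ⊆ ys₁ ++ ys₂
    xs⊆ys₁ys₂ w∈ = ∈-++-∷⁻ ys₁ ys₂ (s (there w∈)) (λ w≡x → All.lookup x∉xs w∈ (sym w≡x))

module _ {A B : Set} (f : A → B) (g : B → A) where

  Unique-map-retraction : {xs : List A} → Unique xs → (∀ x → x ∈ xs → g (f x) ≡ x) → Unique (map f xs)
  Unique-map-retraction {[]} u gf = []
  Unique-map-retraction {x ∷ xs} (x∉xs ∷ u) gf =
    All.map⁺ (All.tabulate (λ {y} y∈ fx≡fy →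
      All.lookup x∉xs y∈ (trans (sym (gf x (here refl))) (trans (cong g fx≡fy) (gf y (there y∈)))))) ∷
    Unique-map-retraction u (λ y y∈ → gf y (there y∈))

  length≤-retraction : (xs : List A) (ys : List B) → Unique xs → (∀ x → x ∈ xs → f x ∈ ys) →
                       (∀ x → x ∈ xs → g (f x) ≡ x) → length xs ≤ length ys
  length≤-retraction xs ys u into gf =
    subst (_≤ length ys) (length-map f xs) (Unique-⊆⇒length≤ (Unique-map-retraction u gf) fxs⊆ys)
    where
    fxs⊆ys : map f xs ⊆ ys
    fxs⊆ys z∈ with ∈-map⁻ f z∈
    ... | x , x∈ , refl = into x x∈

length-≡-inverse : {A B : Set} (f : A → B) (g : B → A) (xs : List A) (ys : List B) → Unique xs → Unique ys →
                   (∀ x → x ∈ xs → f x ∈ ys) → (∀ y → y ∈ ys → g y ∈ xs) →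
                   (∀ x → x ∈ xs → g (f x) ≡ x) → (∀ y → y ∈ ys → f (g y) ≡ y) → length xs ≡ length ys
length-≡-inverse f g xs ys uxs uys fxs gys gf fg =
  ≤-antisym (length≤-retraction f g xs ys uxs fxs gf) (length≤-retraction g f ys xs uys gys fg)

module _ {A B : Set} (_≟B_ : DecidableEquality B) (f : A → B) where

  fibre : List A → B → List A
  fibre xs y = filter (λ x → f x ≟B y) xs

  length-≡-sum-fibres : (xs : List A) (ys : List B) → Unique ys → (∀ x → x ∈ xs → f x ∈ ys) →
                        length xs ≡ sum (map (length ∘ fibre xs) ys)
  length-≡-sum-fibres [] ys u into = sym (sum-map-0 ys)
    where
    sum-map-0 : (ys : List B) → sum (map (length ∘ fibre []) ys) ≡ 0
    sum-map-0 [] = refl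
    sum-map-0 (y ∷ ys) = sum-map-0 ys
  length-≡-sum-fibres (x ∷ xs) ys u into = begin
    1 + length xs
      ≡⟨ cong₂ _+_ (sym (sum-indicator ys u (into x (here refl))))
                   (length-≡-sum-fibres xs ys u (λ y y∈ → into y (there y∈))) ⟩
    sum (map (λ y → indicator (f x ≟B y)) ys) + sum (map (length ∘ fibre xs) ys)
      ≡⟨ sum-map-+ _ _ ys ⟨
    sum (map (λ y → indicator (f x ≟B y) + length (fibre xs y)) ys)
      ≡⟨ sum-map-cong _ _ ys (λ y _ → length-fibre-∷ y) ⟩
    sum (map (length ∘ fibre (x ∷ xs)) ys) ∎
    where
    open ≡-Reasoning
    indicator : {P : Set} → Dec P → ℕ
    indicator (yes _) = 1
    indicator (no _) = 0
    length-fibre-∷ : ∀ y → indicator (f x ≟B y) + length (fibre xs y) ≡ length (fibre (x ∷ xs) y)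
    length-fibre-∷ y with f x ≟B y
    ... | yes _ = refl
    ... | no _ = refl
    sum-indicator-∉ : (ys : List B) → (∀ y → y ∈ ys → f x ≢ y) → sum (map (λ y → indicator (f x ≟B y)) ys) ≡ 0
    sum-indicator-∉ [] ∉ = refl
    sum-indicator-∉ (y ∷ ys) ∉ with f x ≟B y
    ... | yes fx≡y = ⊥-elim (∉ y (here refl) fx≡y)
    ... | no _ = sum-indicator-∉ ys (λ w w∈ → ∉ w (there w∈))
    sum-indicator : (ys : List B) → Unique ys → f x ∈ ys → sum (map (λ y → indicator (f x ≟B y)) ys) ≡ 1
    sum-indicator (y ∷ ys) (y∉ys ∷ u) fx∈ with f x ≟B y
    sum-indicator (y ∷ ys) (y∉ys ∷ u) fx∈ | yes refl =
      cong suc (sum-indicator-∉ ys (λ w w∈ fx≡w → All.lookup y∉ys w∈ fx≡w))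
    sum-indicator (y ∷ ys) (y∉ys ∷ u) (here refl) | no fx≢y = ⊥-elim (fx≢y refl)
    sum-indicator (y ∷ ys) (y∉ys ∷ u) (there fx∈) | no fx≢y = sum-indicator ys u fx∈

module _ {A : Set} {P Q : A → Set} (P? : ∀ x → Dec (P x)) (Q? : ∀ x → Dec (Q x)) where

  filter-filter-⇒ : (xs : List A) → (∀ x → x ∈ xs → P x → Q x) → filter P? (filter Q? xs) ≡ filter P? xs
  filter-filter-⇒ [] P⇒Q = refl
  filter-filter-⇒ (x ∷ xs) P⇒Q with Q? x | P? x
  ... | yes _ | yes px = trans (filter-accept P? px) (cong (x ∷_) (filter-filter-⇒ xs (λ y y∈ → P⇒Q y (there y∈))))
  ... | yes _ | no ¬px = trans (filter-reject P? ¬px) (filter-filter-⇒ xs (λ y y∈ → P⇒Q y (there y∈)))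
  ... | no ¬qx | yes px = ⊥-elim (¬qx (P⇒Q x (here refl) px))
  ... | no _ | no _ = filter-filter-⇒ xs (λ y y∈ → P⇒Q y (there y∈))

length-filter-none : {A : Set} {P : A → Set} (P? : ∀ x → Dec (P x)) (xs : List A) →
                     (∀ x → x ∈ xs → ¬ P x) → length (filter P? xs) ≡ 0
length-filter-none P? xs none = cong length (filter-none P? (All.tabulate (λ {x} x∈ → none x x∈)))

_<lex_ : ∀ {n} → Vec ℕ n → Vec ℕ n → Set
_<lex_ = Lex.Lex-< _≡_ _<_

_<lex?_ : ∀ {n} (u v : Vec ℕ n) → Dec (u <lex v)
_<lex?_ = Lex.<-decidable _≟_ _<?_

<lex-irrefl : ∀ {n} {v : Vec ℕ n} → ¬ (v <lex v)
<lex-irrefl = Lex.<-irrefl <-irrefl (≡⇒Pointwise-≡ refl)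

<lex⇒≢ : ∀ {n} {u v : Vec ℕ n} → u <lex v → u ≢ v
<lex⇒≢ u<v refl = <lex-irrefl u<v

<lex-asym : ∀ {n} {u v : Vec ℕ n} → u <lex v → ¬ (v <lex u)
<lex-asym = Lex.<-asym sym <-resp₂-≡ <-asym

+-monoˡ-<lex : ∀ {n} {u v : Vec ℕ n} (w : Vec ℕ n) → u <lex v → zipWith _+_ u w <lex zipWith _+_ v w
+-monoˡ-<lex (z ∷ w) (this x<y m≡n) = this (+-monoˡ-< z x<y) m≡n
+-monoˡ-<lex (z ∷ w) (next refl u<v) = next refl (+-monoˡ-<lex w u<v)

+-cancelʳ-<lex : ∀ {n} (u v w : Vec ℕ n) → zipWith _+_ u w <lex zipWith _+_ v w → u <lex v
+-cancelʳ-<lex u v w u+w<v+w with Lex.<-cmp sym <-cmp u v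
... | tri< u<v _ _ = u<v
... | tri≈ _ u≋v _ with refl ← Pointwise-≡⇒≡ u≋v = ⊥-elim (<lex-irrefl u+w<v+w)
... | tri> _ _ v<u = ⊥-elim (<lex-asym u+w<v+w (+-monoˡ-<lex w v<u))

[a*q+b]∸a*s≡a*[q∸s]+b : ∀ a q b s → b < a → a * s ≤ a * q + b → a * q + b ∸ a * s ≡ a * (q ∸ s) + b
[a*q+b]∸a*s≡a*[q∸s]+b a q b s b<a a*s≤ with s ≤? q
... | yes s≤q = trans (+-∸-comm b (*-monoʳ-≤ a s≤q)) (cong (_+ b) (sym (*-distribˡ-∸ a q s)))
... | no s≰q = ⊥-elim (<-irrefl refl (subst (a * suc q <_) (trans (+-comm (a * q) a) (sym (*-suc a q)))
                (≤-<-trans (≤-trans (*-monoʳ-≤ a (≰⇒> s≰q)) a*s≤) (+-monoʳ-< (a * q) b<a))))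

vecs-sorted : ∀ b len → AllPairs _<lex_ (vecs b len)
vecs-sorted b zero = [] ∷ []
vecs-sorted b (suc len) = AllPairs.concat⁺
  (All.map⁺ (All.universal (λ x → AllPairs.map⁺ (AllPairs.map (next refl) (vecs-sorted b len))) (upTo (suc b))))
  (AllPairs.map⁺ (AllPairs.applyUpTo⁺₁ (λ x → x) (suc b) (λ i<j _ →
     All.map⁺ (All.universal (λ _ → All.map⁺ (All.universal (λ _ → this i<j refl) (vecs b len))) (vecs b len)))))

∈-vecs : ∀ b {len} (v : Vec ℕ len) → (∀ i → lookup v i ≤ b) → v ∈ vecs b len
∈-vecs b [] v≤b = here refl
∈-vecs b {suc len} (x ∷ v) v≤b = ∈-concatMap⁺ (λ y → map (y ∷_) (vecs b len))
  (lose {P = λ y → (x ∷ v) ∈ map (y ∷_) (vecs b len)} (∈-upTo⁺ (s≤s (v≤b Fin.zero)))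
        (∈-map⁺ (x ∷_) (∈-vecs b v (λ i → v≤b (Fin.suc i)))))

lookup-ext : ∀ {n} {u v : Vec ℕ n} → (∀ i → lookup u i ≡ lookup v i) → u ≡ v
lookup-ext {u = u} {v} e = trans (sym (tabulate∘lookup u)) (trans (tabulate-cong e) (tabulate∘lookup v))

_⊕_ : ∀ {n} → Vec ℕ n → Vec ℕ n → Vec ℕ n
_⊕_ = zipWith _+_

lookup-⊕ : ∀ {n} (u v : Vec ℕ n) i → lookup (u ⊕ v) i ≡ lookup u i + lookup v i
lookup-⊕ u v i = lookup-zipWith _+_ i u v

freq-lookup : ∀ {n} (v : Vec ℕ n) i → freq v (suc (toℕ i)) ≡ lookup v i
freq-lookup {n} v i with suc (toℕ i) ≤? n
... | yes q = cong (lookup v) (fromℕ<-toℕ i q)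
... | no ¬q = ⊥-elim (¬q (toℕ<n i))

freq-ext : ∀ {n} {u v : Vec ℕ n} → (∀ N → freq u N ≡ freq v N) → u ≡ v
freq-ext {u = u} {v} e = lookup-ext (λ i → trans (sym (freq-lookup u i)) (trans (e (suc (toℕ i))) (freq-lookup v i)))

freq-⊕ : ∀ {n} (u v : Vec ℕ n) N → freq (u ⊕ v) N ≡ freq u N + freq v N
freq-⊕ u v zero = refl
freq-⊕ {n} u v (suc N) with suc N ≤? n
... | yes q = lookup-zipWith _+_ (fromℕ< q) u v
... | no _ = refl

freq-beyond-length : ∀ {n} (v : Vec ℕ n) N → n < N → freq v N ≡ 0
freq-beyond-length v zero _ = refl
freq-beyond-length {n} v (suc N) n<N with suc N ≤? n
... | yes N≤n = ⊥-elim (<-irrefl refl (<-≤-trans n<N N≤n))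
... | no _ = refl

N*freq≤weight : ∀ {n} (v : Vec ℕ n) N → N * freq v N ≤ weight v
N*freq≤weight {n} v N with N ≤? n
... | yes N≤n = ≤-sum-map (λ N → N * freq v N) (∈-upTo⁺ (s≤s N≤n))
... | no N≰n = subst (_≤ weight v) (sym (trans (cong (N *_) (freq-beyond-length v N (≰⇒> N≰n))) (*-zeroʳ N))) z≤n

lookup≤weight : ∀ {n} (v : Vec ℕ n) i → lookup v i ≤ weight v
lookup≤weight v i = subst (_≤ weight v) (freq-lookup v i)
  (≤-trans (m≤m+n (freq v (suc (toℕ i))) _) (N*freq≤weight v (suc (toℕ i))))

freq-beyond-weight : ∀ {n} (u : Vec ℕ n) N → weight u < N → freq u N ≡ 0
freq-beyond-weight u N w<N with freq u N in eq
... | zero = refl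
... | suc f = ⊥-elim (<-irrefl refl (<-≤-trans w<N
                (≤-trans (m≤m*n N (suc f)) (subst (λ z → N * z ≤ weight u) eq (N*freq≤weight u N)))))

∈-vecs-weight : ∀ {n} b (v : Vec ℕ n) → weight v ≤ b → v ∈ vecs b n
∈-vecs-weight b v w≤b = ∈-vecs b v (λ i → ≤-trans (lookup≤weight v i) w≤b)

weight-⊕ : ∀ {n} (u v : Vec ℕ n) → weight (u ⊕ v) ≡ weight u + weight v
weight-⊕ {n} u v = trans (sum-map-cong _ _ (upTo (suc n))
    (λ N _ → trans (cong (N *_) (freq-⊕ u v N)) (*-distribˡ-+ N (freq u N) (freq v N))))
  (sum-map-+ (λ N → N * freq u N) (λ N → N * freq v N) (upTo (suc n)))

weight-upTo : ∀ {n} (v : Vec ℕ n) d → weight v ≡ sum (map (λ N → N * freq v N) (upTo (suc n + d)))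
weight-upTo {n} v zero = cong (λ z → sum (map (λ N → N * freq v N) (upTo z))) (sym (+-identityʳ (suc n)))
weight-upTo {n} v (suc d) = begin
  weight v                              ≡⟨ weight-upTo v d ⟩
  sum (map g (upTo K))                  ≡⟨ +-identityʳ _ ⟨
  sum (map g (upTo K)) + 0              ≡⟨ cong (sum (map g (upTo K)) +_) gK≡0 ⟨
  sum (map g (upTo K)) + (g K + 0)      ≡⟨ sum-++ (map g (upTo K)) (g K ∷ []) ⟨
  sum (map g (upTo K) ++ g K ∷ [])      ≡⟨ cong sum (map-++ g (upTo K) (K ∷ [])) ⟨
  sum (map g (upTo K ++ K ∷ []))        ≡⟨ cong (λ z → sum (map g z)) (upTo-∷ʳ K) ⟩
  sum (map g (upTo (suc K)))            ≡⟨ cong (λ z → sum (map g (upTo z))) (+-suc (suc n) d) ⟨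
  sum (map g (upTo (suc n + suc d)))    ∎
  where
  open ≡-Reasoning
  g = λ N → N * freq v N
  K = suc n + d
  gK≡0 : g K + 0 ≡ 0
  gK≡0 = trans (+-identityʳ (g K)) (trans (cong (K *_) (freq-beyond-length v K (m≤m+n (suc n) d))) (*-zeroʳ K))

weight-cong : ∀ {a b} (u : Vec ℕ a) (v : Vec ℕ b) → (∀ N → freq u N ≡ freq v N) → weight u ≡ weight v
weight-cong {a} {b} u v e = begin
  weight u                                           ≡⟨ weight-upTo u b ⟩
  sum (map (λ N → N * freq u N) (upTo (suc a + b)))
    ≡⟨ sum-map-cong _ _ (upTo (suc a + b)) (λ N _ → cong (N *_) (e N)) ⟩
  sum (map (λ N → N * freq v N) (upTo (suc a + b)))
    ≡⟨ cong (λ z → sum (map (λ N → N * freq v N) (upTo (suc z)))) (+-comm a b) ⟩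
  sum (map (λ N → N * freq v N) (upTo (suc b + a)))  ≡⟨ weight-upTo v a ⟨
  weight v                                           ∎
  where open ≡-Reasoning

weight≡0⇒≡replicate : ∀ {n} (v : Vec ℕ n) → weight v ≡ 0 → v ≡ replicate n 0
weight≡0⇒≡replicate v w≡0 =
  lookup-ext (λ i → trans (n≤0⇒n≡0 (subst (lookup v i ≤_) w≡0 (lookup≤weight v i))) (sym (lookup-replicate i 0)))

weight-replicate-0 : ∀ n → weight (replicate n 0) ≡ 0
weight-replicate-0 n =
  trans (sum-map-cong _ (λ _ → 0) (upTo (suc n)) (λ N _ → trans (cong (N *_) (freq-0 N)) (*-zeroʳ N)))
        (sum-0s (upTo (suc n)))
  where
  sum-0s : (xs : List ℕ) → sum (map (λ _ → 0) xs) ≡ 0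
  sum-0s [] = refl
  sum-0s (_ ∷ xs) = sum-0s xs
  freq-0 : ∀ N → freq (replicate n 0) N ≡ 0
  freq-0 zero = refl
  freq-0 (suc N) with suc N ≤? n
  ... | yes q = lookup-replicate (fromℕ< q) 0
  ... | no _ = refl

module Splitting (m : ℕ) .{{m≢0 : NonZero m}} where

  -- The units digit of f_N, for N prime to m, is the (0,0) entry of M_N and is never moved by ρ;
  -- fixed N f is that digit (0 when m ∣ N) and moving N f the rest.  Both are computed from r = N % m.
  movingᵣ : ℕ → ℕ → ℕ
  movingᵣ zero x = x
  movingᵣ (suc _) x = m * (x / m)

  fixedᵣ : ℕ → ℕ → ℕ
  fixedᵣ zero x = 0
  fixedᵣ (suc _) x = x % m

  moving : ℕ → ℕ → ℕ
  moving N = movingᵣ (N % m)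

  fixed : ℕ → ℕ → ℕ
  fixed N = fixedᵣ (N % m)

  movingᵣ+fixedᵣ : ∀ r x → movingᵣ r x + fixedᵣ r x ≡ x
  movingᵣ+fixedᵣ zero x = +-identityʳ x
  movingᵣ+fixedᵣ (suc r) x = begin
    m * (x / m) + x % m ≡⟨ +-comm (m * (x / m)) (x % m) ⟩
    x % m + m * (x / m) ≡⟨ cong (x % m +_) (*-comm m (x / m)) ⟩
    x % m + x / m * m   ≡⟨ m≡m%n+[m/n]*n x m ⟨
    x                   ∎
    where open ≡-Reasoning

  moving+fixed : ∀ N x → moving N x + fixed N x ≡ x
  moving+fixed N = movingᵣ+fixedᵣ (N % m)

  moving-zero : ∀ N → moving N 0 ≡ 0
  moving-zero N with N % m
  ... | zero = refl
  ... | suc _ = trans (cong (m *_) (0/n≡0 m)) (*-zeroʳ m)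

  fixed-zero : ∀ N → fixed N 0 ≡ 0
  fixed-zero N with N % m
  ... | zero = refl
  ... | suc _ = m<n⇒m%n≡m (>-nonZero⁻¹ m)

  moving-∣ : ∀ N x → N % m ≡ 0 → moving N x ≡ x
  moving-∣ N x N%m≡0 rewrite N%m≡0 = refl

  fixed-∣ : ∀ N x → N % m ≡ 0 → fixed N x ≡ 0
  fixed-∣ N x N%m≡0 rewrite N%m≡0 = refl

  moving-∤ : ∀ N x r → N % m ≡ suc r → moving N x ≡ m * (x / m)
  moving-∤ N x r N%m≡1+r rewrite N%m≡1+r = refl

  fixed-∤ : ∀ N x r → N % m ≡ suc r → fixed N x ≡ x % m
  fixed-∤ N x r N%m≡1+r rewrite N%m≡1+r = refl

  fixedᵣ-movingᵣ : ∀ r x → fixedᵣ r (movingᵣ r x) ≡ 0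
  fixedᵣ-movingᵣ zero x = refl
  fixedᵣ-movingᵣ (suc r) x = trans (cong (_% m) (*-comm m (x / m))) (m*n%n≡0 (x / m) m)

  movingᵣ-fixedᵣ : ∀ r x → movingᵣ r (fixedᵣ r x) ≡ 0
  movingᵣ-fixedᵣ zero x = refl
  movingᵣ-fixedᵣ (suc r) x = trans (cong (m *_) (m<n⇒m/n≡0 (m%n<n x m))) (*-zeroʳ m)

  movingᵣ-fixedᵣ-+ : ∀ r a l → fixedᵣ r a ≡ 0 → movingᵣ r l ≡ 0 →
                     movingᵣ r (a + l) ≡ a × fixedᵣ r (a + l) ≡ l
  movingᵣ-fixedᵣ-+ zero a l _ l≡0 = trans (cong (a +_) l≡0) (+-identityʳ a) , sym l≡0
  movingᵣ-fixedᵣ-+ (suc r) a l a%m≡0 m*[l/m]≡0 = moving≡a , fixed≡l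
    where
    l%m≡l : l % m ≡ l
    l%m≡l = trans (sym (+-identityˡ (l % m))) (trans (cong (_+ l % m) (sym m*[l/m]≡0)) (movingᵣ+fixedᵣ (suc r) l))
    fixed≡l : (a + l) % m ≡ l
    fixed≡l = trans (%-distribˡ-+ a l m) (trans (cong (λ z → (z + l % m) % m) a%m≡0) (trans (m%n%n≡m%n l m) l%m≡l))
    moving≡a : m * ((a + l) / m) ≡ a
    moving≡a = +-cancelʳ-≡ l _ _ (trans (cong (m * ((a + l) / m) +_) (sym fixed≡l)) (movingᵣ+fixedᵣ (suc r) (a + l)))

  m∣N*moving : ∀ N x → m ∣ N * moving N x
  m∣N*moving N x = go (N % m) refl
    where
    go : ∀ r → N % m ≡ r → m ∣ N * movingᵣ (N % m) x
    go zero N%m≡0 rewrite N%m≡0 = ∣-trans (m%n≡0⇒n∣m N m N%m≡0) (m∣m*n x)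
    go (suc r) N%m≡1+r rewrite N%m≡1+r = ∣-trans (m∣m*n (x / m)) (n∣m*n N)

  digitAt : ℕ → ℕ → ℕ
  digitAt x ℓ = (_/_ x (m ^ ℓ) {{m^n≢0 m ℓ}}) % m

  digitAt-moving : ∀ N x ℓ → digitAt (moving N x) (suc ℓ) ≡ digitAt x (suc ℓ)
  digitAt-moving N x ℓ with N % m
  ... | zero = refl
  ... | suc _ = cong (_% m) (trans (m*n/m*o≡n/o m (x / m) (m ^ ℓ) {{m^n≢0 m ℓ}} {{m^n≢0 m (suc ℓ)}})
                                   (m/n/o≡m/[n*o] x m (m ^ ℓ) {{m≢0}} {{m^n≢0 m ℓ}} {{m^n≢0 m (suc ℓ)}}))

  mapFreq : ∀ {n} → (ℕ → ℕ → ℕ) → Vec ℕ n → Vec ℕ n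
  mapFreq F v = tabulate (λ i → F (suc (toℕ i)) (lookup v i))

  movingPart : ∀ {n} → Vec ℕ n → Vec ℕ n
  movingPart = mapFreq moving

  fixedPart : ∀ {n} → Vec ℕ n → Vec ℕ n
  fixedPart = mapFreq fixed

  AllMoving : ∀ {n} → Vec ℕ n → Set
  AllMoving v = ∀ i → fixed (suc (toℕ i)) (lookup v i) ≡ 0

  AllFixed : ∀ {n} → Vec ℕ n → Set
  AllFixed v = ∀ i → moving (suc (toℕ i)) (lookup v i) ≡ 0

  lookup-mapFreq : ∀ {n} (v : Vec ℕ n) F i → lookup (mapFreq F v) i ≡ F (suc (toℕ i)) (lookup v i)
  lookup-mapFreq v F i = lookup∘tabulate _ i

  freq-mapFreq : ∀ {n} (v : Vec ℕ n) F → (∀ N → F N 0 ≡ 0) → ∀ N → freq (mapFreq F v) N ≡ F N (freq v N)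
  freq-mapFreq v F F0 zero = sym (F0 0)
  freq-mapFreq {n} v F F0 (suc N) with suc N ≤? n
  ... | yes q = trans (lookup∘tabulate _ (fromℕ< q)) (cong (λ z → F (suc z) (lookup v (fromℕ< q))) (toℕ-fromℕ< q))
  ... | no _ = sym (F0 (suc N))

  freq-movingPart : ∀ {n} (v : Vec ℕ n) N → freq (movingPart v) N ≡ moving N (freq v N)
  freq-movingPart v = freq-mapFreq v moving moving-zero

  movingPart⊕fixedPart : ∀ {n} (v : Vec ℕ n) → movingPart v ⊕ fixedPart v ≡ v
  movingPart⊕fixedPart v = lookup-ext λ i → begin
    lookup (movingPart v ⊕ fixedPart v) i
      ≡⟨ lookup-⊕ (movingPart v) (fixedPart v) i ⟩
    lookup (movingPart v) i + lookup (fixedPart v) i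
      ≡⟨ cong₂ _+_ (lookup-mapFreq v moving i) (lookup-mapFreq v fixed i) ⟩
    moving (suc (toℕ i)) (lookup v i) + fixed (suc (toℕ i)) (lookup v i)
      ≡⟨ moving+fixed (suc (toℕ i)) (lookup v i) ⟩
    lookup v i ∎
    where open ≡-Reasoning

  AllMoving-movingPart : ∀ {n} (v : Vec ℕ n) → AllMoving (movingPart v)
  AllMoving-movingPart v i =
    trans (cong (fixed (suc (toℕ i))) (lookup-mapFreq v moving i)) (fixedᵣ-movingᵣ (suc (toℕ i) % m) (lookup v i))

  AllFixed-fixedPart : ∀ {n} (v : Vec ℕ n) → AllFixed (fixedPart v)
  AllFixed-fixedPart v i =
    trans (cong (moving (suc (toℕ i))) (lookup-mapFreq v fixed i)) (movingᵣ-fixedᵣ (suc (toℕ i) % m) (lookup v i))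

  split-⊕ : ∀ {n} (a l : Vec ℕ n) → AllMoving a → AllFixed l → movingPart (a ⊕ l) ≡ a × fixedPart (a ⊕ l) ≡ l
  split-⊕ a l a-moving l-fixed = lookup-ext (λ i → trans (lookup-split moving i) (proj₁ (parts i))) ,
                                 lookup-ext (λ i → trans (lookup-split fixed i) (proj₂ (parts i)))
    where
    lookup-split : ∀ F i → lookup (mapFreq F (a ⊕ l)) i ≡ F (suc (toℕ i)) (lookup a i + lookup l i)
    lookup-split F i = trans (lookup-mapFreq (a ⊕ l) F i) (cong (F (suc (toℕ i))) (lookup-⊕ a l i))
    parts : ∀ i → movingᵣ (suc (toℕ i) % m) (lookup a i + lookup l i) ≡ lookup a i ×
                  fixedᵣ (suc (toℕ i) % m) (lookup a i + lookup l i) ≡ lookup l i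
    parts i = movingᵣ-fixedᵣ-+ (suc (toℕ i) % m) (lookup a i) (lookup l i) (a-moving i) (l-fixed i)

  AllMoving⇒movingPart≡ : ∀ {n} (v : Vec ℕ n) → AllMoving v → movingPart v ≡ v
  AllMoving⇒movingPart≡ v v-moving = lookup-ext (λ i → begin
    lookup (movingPart v) i ≡⟨ lookup-mapFreq v moving i ⟩
    moving (suc (toℕ i)) (lookup v i) ≡⟨ +-identityʳ _ ⟨
    moving (suc (toℕ i)) (lookup v i) + 0 ≡⟨ cong (moving (suc (toℕ i)) (lookup v i) +_) (v-moving i) ⟨
    moving (suc (toℕ i)) (lookup v i) + fixed (suc (toℕ i)) (lookup v i) ≡⟨ moving+fixed (suc (toℕ i)) (lookup v i) ⟩
    lookup v i ∎)
    where open ≡-Reasoning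

  movingPart≡⇒AllMoving : ∀ {n} (v : Vec ℕ n) → movingPart v ≡ v → AllMoving v
  movingPart≡⇒AllMoving v e = subst AllMoving e (AllMoving-movingPart v)

  fixedPart≡⇒AllFixed : ∀ {n} (v : Vec ℕ n) → fixedPart v ≡ v → AllFixed v
  fixedPart≡⇒AllFixed v e = subst AllFixed e (AllFixed-fixedPart v)

  AllFixed⇒fixedPart≡ : ∀ {n} (v : Vec ℕ n) → AllFixed v → fixedPart v ≡ v
  AllFixed⇒fixedPart≡ v v-fixed = lookup-ext (λ i → begin
    lookup (fixedPart v) i ≡⟨ lookup-mapFreq v fixed i ⟩
    fixed (suc (toℕ i)) (lookup v i) ≡⟨ cong (_+ fixed (suc (toℕ i)) (lookup v i)) (v-fixed i) ⟨
    moving (suc (toℕ i)) (lookup v i) + fixed (suc (toℕ i)) (lookup v i) ≡⟨ moving+fixed (suc (toℕ i)) (lookup v i) ⟩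
    lookup v i ∎)
    where open ≡-Reasoning

  movingFreq : (ℕ → ℕ) → ℕ → ℕ
  movingFreq f N = moving N (f N)

  rowFreq : ℕ → (ℕ → ℕ) → ℕ → ℕ → ℕ
  rowFreq L f j k = sum (map (λ ℓ → matrix′ m f j k ℓ * m ^ ℓ) (upTo L))

  kOf-∤ : ∀ N r → suc N % m ≡ suc r → kOf m (suc N) ≡ 0
  kOf-∤ N r N%m≡1+r rewrite N%m≡1+r = refl

  kOf-∣ : ∀ N → suc N % m ≡ 0 → ∃ λ k → kOf m (suc N) ≡ suc k
  kOf-∣ N N%m≡0 rewrite N%m≡0 = _ , refl

  jOf-kOf≡0 : ∀ N → kOf m N ≡ 0 → jOf m N ≡ N
  jOf-kOf≡0 N k≡0 = go (kOf m N) k≡0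
    where
    go : ∀ k → k ≡ 0 → _/_ N (m ^ k) {{m^n≢0 m k}} ≡ N
    go .0 refl = n/1≡n N

  freq′-∤ : ∀ L f N r → suc N % m ≡ suc r → freq′ m L f (suc N) ≡ rowFreq L f (suc N) 0
  freq′-∤ L f N r N%m≡1+r = cong₂ (rowFreq L f) (jOf-kOf≡0 (suc N) k≡0) k≡0
    where k≡0 = kOf-∤ N r N%m≡1+r

  freq′-cong : ∀ L (f g : ℕ → ℕ) → (∀ N → f N ≡ g N) → ∀ N → freq′ m L f N ≡ freq′ m L g N
  freq′-cong L f g f≗g N = cong sum (map-cong (λ ℓ → cong (_* m ^ ℓ) (matrix′-cong (kOf m N) ℓ)) (upTo L))
    where
    matrix′-cong : ∀ k ℓ → matrix′ m f (jOf m N) k ℓ ≡ matrix′ m g (jOf m N) k ℓ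
    matrix′-cong zero ℓ = cong (λ x → digitAt x 0) (f≗g (jOf m N * m ^ ℓ))
    matrix′-cong (suc k) ℓ = cong (λ x → digitAt x (suc ℓ)) (f≗g (jOf m N * m ^ k))

  rowFreq-suc-moving : ∀ L f j k → rowFreq L f j (suc k) ≡ rowFreq L (movingFreq f) j (suc k)
  rowFreq-suc-moving L f j k =
    cong sum (map-cong (λ ℓ → cong (_* m ^ ℓ) (sym (digitAt-moving (j * m ^ k) (f (j * m ^ k)) ℓ))) (upTo L))

  -- Row 0 of M′_N is column 0 of M_N: the units digits of the parts N m^ℓ, divisible by m for ℓ ≥ 1.
  module _ (L : ℕ) (N r : ℕ) (N%m≡1+r : N % m ≡ suc r) where

    private
      upperRow : (ℕ → ℕ) → ℕ
      upperRow f = sum (map (λ ℓ → matrix′ m f N 0 ℓ * m ^ ℓ) (applyUpTo suc L))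

      entry₀₀ : ∀ f → matrix′ m f N 0 0 * m ^ 0 ≡ f N % m
      entry₀₀ f = trans (*-identityʳ _) (trans (cong (_% m) (n/1≡n (f (N * 1)))) (cong (λ z → f z % m) (*-identityʳ N)))

      entry₀₀-moving : ∀ f → matrix′ m (movingFreq f) N 0 0 * m ^ 0 ≡ 0
      entry₀₀-moving f = trans (entry₀₀ (movingFreq f))
        (trans (cong (_% m) (trans (moving-∤ N (f N) r N%m≡1+r) (*-comm m (f N / m)))) (m*n%n≡0 (f N / m) m))

      part∈upperRow-∣ : ∀ {ℓ} → ℓ ∈ applyUpTo suc L → (N * m ^ ℓ) % m ≡ 0
      part∈upperRow-∣ ℓ∈ with ∈-applyUpTo⁻ suc ℓ∈
      ... | i , _ , refl =
        trans (cong (_% m) (trans (cong (N *_) (*-comm m (m ^ i))) (sym (*-assoc N (m ^ i) m)))) (m*n%n≡0 (N * m ^ i) m)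

      upperRow-moving : ∀ f → upperRow f ≡ upperRow (movingFreq f)
      upperRow-moving f = sum-map-cong _ _ (applyUpTo suc L) (λ ℓ ℓ∈ →
        cong (λ x → digitAt x 0 * m ^ ℓ) (sym (moving-∣ (N * m ^ ℓ) (f (N * m ^ ℓ)) (part∈upperRow-∣ ℓ∈))))

      m∣upperRow : ∀ f → m ∣ upperRow f
      m∣upperRow f = ∣-sum-map _ (applyUpTo suc L) (λ ℓ ℓ∈ → go ℓ (∈-applyUpTo⁻ suc ℓ∈))
        where
        go : ∀ ℓ → ∃ (λ i → i < L × ℓ ≡ suc i) → m ∣ matrix′ m f N 0 ℓ * m ^ ℓ
        go ℓ (i , _ , refl) = ∣-trans (m∣m*n (m ^ i)) (n∣m*n (matrix′ m f N 0 (suc i)))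

    rowFreq-zero-moving : ∀ f → rowFreq (suc L) f N 0 ≡ rowFreq (suc L) (movingFreq f) N 0 + f N % m
    rowFreq-zero-moving f = begin
      matrix′ m f N 0 0 * m ^ 0 + upperRow f                   ≡⟨ cong₂ _+_ (entry₀₀ f) (upperRow-moving f) ⟩
      f N % m + upperRow (movingFreq f)                         ≡⟨ +-comm (f N % m) _ ⟩
      upperRow (movingFreq f) + f N % m
        ≡⟨ cong (λ z → z + upperRow (movingFreq f) + f N % m) (entry₀₀-moving f) ⟨
      matrix′ m (movingFreq f) N 0 0 * m ^ 0 + upperRow (movingFreq f) + f N % m ∎
      where open ≡-Reasoning

    m∣rowFreq-zero-moving : ∀ f → m ∣ rowFreq (suc L) (movingFreq f) N 0
    m∣rowFreq-zero-moving f =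
      subst (m ∣_) (cong (_+ upperRow (movingFreq f)) (sym (entry₀₀-moving f))) (m∣upperRow (movingFreq f))

  freq′-moving+fixed : ∀ L f N →
                       freq′ m (suc L) f (suc N) ≡ freq′ m (suc L) (movingFreq f) (suc N) + fixed (suc N) (f (suc N))
  freq′-moving+fixed L f N = go (suc N % m) refl
    where
    open ≡-Reasoning
    go : ∀ r → suc N % m ≡ r →
         freq′ m (suc L) f (suc N) ≡ freq′ m (suc L) (movingFreq f) (suc N) + fixed (suc N) (f (suc N))
    go zero N%m≡0 with k , k≡1+k ← kOf-∣ N N%m≡0 = begin
      freq′ m (suc L) f (suc N)                      ≡⟨ cong (rowFreq (suc L) f j) k≡1+k ⟩
      rowFreq (suc L) f j (suc k)                    ≡⟨ rowFreq-suc-moving (suc L) f j k ⟩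
      rowFreq (suc L) (movingFreq f) j (suc k)       ≡⟨ cong (rowFreq (suc L) (movingFreq f) j) k≡1+k ⟨
      freq′ m (suc L) (movingFreq f) (suc N)         ≡⟨ +-identityʳ _ ⟨
      freq′ m (suc L) (movingFreq f) (suc N) + 0
        ≡⟨ cong (freq′ m (suc L) (movingFreq f) (suc N) +_) (fixed-∣ (suc N) (f (suc N)) N%m≡0) ⟨
      freq′ m (suc L) (movingFreq f) (suc N) + fixed (suc N) (f (suc N)) ∎
      where j = jOf m (suc N)
    go (suc r) N%m≡1+r = begin
      freq′ m (suc L) f (suc N)                                        ≡⟨ freq′-∤ (suc L) f N r N%m≡1+r ⟩
      rowFreq (suc L) f (suc N) 0                                      ≡⟨ rowFreq-zero-moving L (suc N) r N%m≡1+r f ⟩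
      rowFreq (suc L) (movingFreq f) (suc N) 0 + f (suc N) % m
        ≡⟨ cong₂ _+_ (freq′-∤ (suc L) (movingFreq f) N r N%m≡1+r) (fixed-∤ (suc N) (f (suc N)) r N%m≡1+r) ⟨
      freq′ m (suc L) (movingFreq f) (suc N) + fixed (suc N) (f (suc N)) ∎

  freq′-%-∤ : ∀ L f N r → suc N % m ≡ suc r → freq′ m (suc L) f (suc N) % m ≡ f (suc N) % m
  freq′-%-∤ L f N r N%m≡1+r with m∣rowFreq-zero-moving L (suc N) r N%m≡1+r f
  ... | divides q eq = begin
    freq′ m (suc L) f (suc N) % m                                ≡⟨ cong (_% m) (freq′-∤ (suc L) f N r N%m≡1+r) ⟩
    rowFreq (suc L) f (suc N) 0 % m                              ≡⟨ cong (_% m) (rowFreq-zero-moving L (suc N) r N%m≡1+r f) ⟩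
    (rowFreq (suc L) (movingFreq f) (suc N) 0 + f (suc N) % m) % m ≡⟨ cong (λ z → (z + f (suc N) % m) % m) eq ⟩
    (q * m + f (suc N) % m) % m                                  ≡⟨ cong (_% m) (+-comm (q * m) _) ⟩
    (f (suc N) % m + q * m) % m                                  ≡⟨ [m+kn]%n≡m%n (f (suc N) % m) q m ⟩
    f (suc N) % m % m                                            ≡⟨ m%n%n≡m%n (f (suc N)) m ⟩
    f (suc N) % m                                                ∎
    where open ≡-Reasoning

  lookup-ρ : ∀ {n} (u : Vec ℕ n) i → lookup (ρ m u) i ≡ freq′ m (suc n) (freq u) (suc (toℕ i))
  lookup-ρ u i = lookup∘tabulate _ i

  ρ-split : ∀ {n} (u : Vec ℕ n) → ρ m u ≡ ρ m (movingPart u) ⊕ fixedPart u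
  ρ-split {n} u = lookup-ext λ i → begin
    lookup (ρ m u) i
      ≡⟨ lookup-ρ u i ⟩
    freq′ m (suc n) (freq u) (suc (toℕ i))
      ≡⟨ freq′-moving+fixed n (freq u) (toℕ i) ⟩
    freq′ m (suc n) (movingFreq (freq u)) (suc (toℕ i)) + fixed (suc (toℕ i)) (freq u (suc (toℕ i)))
      ≡⟨ cong₂ _+_ (sym (freq′-cong (suc n) _ _ (freq-movingPart u) (suc (toℕ i))))
                   (cong (fixed (suc (toℕ i))) (freq-lookup u i)) ⟩
    freq′ m (suc n) (freq (movingPart u)) (suc (toℕ i)) + fixed (suc (toℕ i)) (lookup u i)
      ≡⟨ cong₂ _+_ (lookup-ρ (movingPart u) i) (lookup-mapFreq u fixed i) ⟨
    lookup (ρ m (movingPart u)) i + lookup (fixedPart u) i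
      ≡⟨ lookup-⊕ (ρ m (movingPart u)) (fixedPart u) i ⟨
    lookup (ρ m (movingPart u) ⊕ fixedPart u) i ∎
    where open ≡-Reasoning

  AllMoving-ρ : ∀ {n} (w : Vec ℕ n) → AllMoving w → AllMoving (ρ m w)
  AllMoving-ρ {n} w w-moving i = go (suc (toℕ i) % m) refl
    where
    open ≡-Reasoning
    go : ∀ r → suc (toℕ i) % m ≡ r → fixed (suc (toℕ i)) (lookup (ρ m w) i) ≡ 0
    go zero N%m≡0 = fixed-∣ (suc (toℕ i)) _ N%m≡0
    go (suc r) N%m≡1+r = begin
      fixed (suc (toℕ i)) (lookup (ρ m w) i)      ≡⟨ fixed-∤ (suc (toℕ i)) _ r N%m≡1+r ⟩
      lookup (ρ m w) i % m                        ≡⟨ cong (_% m) (lookup-ρ w i) ⟩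
      freq′ m (suc n) (freq w) (suc (toℕ i)) % m  ≡⟨ freq′-%-∤ n (freq w) (toℕ i) r N%m≡1+r ⟩
      freq w (suc (toℕ i)) % m                    ≡⟨ cong (_% m) (freq-lookup w i) ⟩
      lookup w i % m                              ≡⟨ fixed-∤ (suc (toℕ i)) _ r N%m≡1+r ⟨
      fixed (suc (toℕ i)) (lookup w i)            ≡⟨ w-moving i ⟩
      0                                           ∎

  AllMoving-ρ^ : ∀ {n} t (w : Vec ℕ n) → AllMoving w → AllMoving (ρ^ m t w)
  AllMoving-ρ^ zero w w-moving = w-moving
  AllMoving-ρ^ (suc t) w w-moving = AllMoving-ρ (ρ^ m t w) (AllMoving-ρ^ t w w-moving)

  split-ρ^ : ∀ {n} t (v : Vec ℕ n) →
             movingPart (ρ^ m t (movingPart v) ⊕ fixedPart v) ≡ ρ^ m t (movingPart v) ×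
             fixedPart (ρ^ m t (movingPart v) ⊕ fixedPart v) ≡ fixedPart v
  split-ρ^ t v = split-⊕ (ρ^ m t (movingPart v)) (fixedPart v)
    (AllMoving-ρ^ t (movingPart v) (AllMoving-movingPart v)) (AllFixed-fixedPart v)

  ρ^-split : ∀ {n} t (v : Vec ℕ n) → ρ^ m t v ≡ ρ^ m t (movingPart v) ⊕ fixedPart v
  ρ^-split zero v = sym (movingPart⊕fixedPart v)
  ρ^-split (suc t) v = begin
    ρ m (ρ^ m t v)                              ≡⟨ cong (ρ m) (ρ^-split t v) ⟩
    ρ m u                                       ≡⟨ ρ-split u ⟩
    ρ m (movingPart u) ⊕ fixedPart u            ≡⟨ cong₂ (λ a b → ρ m a ⊕ b) moving≡ fixed≡ ⟩
    ρ m (ρ^ m t (movingPart v)) ⊕ fixedPart v   ∎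
    where
    open ≡-Reasoning
    u = ρ^ m t (movingPart v) ⊕ fixedPart v
    moving≡ = proj₁ (split-ρ^ t v)
    fixed≡ = proj₂ (split-ρ^ t v)

  movingPart-ρ^ : ∀ {n} t {u v : Vec ℕ n} → ρ^ m t v ≡ u → ρ^ m t (movingPart v) ≡ movingPart u
  movingPart-ρ^ t {v = v} e = trans (sym (proj₁ (split-ρ^ t v))) (cong movingPart (trans (sym (ρ^-split t v)) e))

  fixedPart-ρ^ : ∀ {n} t {u v : Vec ℕ n} → ρ^ m t v ≡ u → fixedPart v ≡ fixedPart u
  fixedPart-ρ^ t {v = v} e = trans (sym (proj₂ (split-ρ^ t v))) (cong fixedPart (trans (sym (ρ^-split t v)) e))

  ρ^-movingPart : ∀ {n} t {u v : Vec ℕ n} → fixedPart v ≡ fixedPart u →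
                  ρ^ m t (movingPart v) ≡ movingPart u → ρ^ m t v ≡ u
  ρ^-movingPart t {u} {v} fixed≡ moving≡ =
    trans (ρ^-split t v) (trans (cong₂ _⊕_ moving≡ fixed≡) (movingPart⊕fixedPart u))

  firstReturn-cong : ∀ {n} (u v : Vec ℕ n) →
                     (∀ t → ρ^ m t u ≡ u → ρ^ m t v ≡ v) → (∀ t → ρ^ m t v ≡ v → ρ^ m t u ≡ u) →
                     ∀ ts → firstReturn m u ts ≡ firstReturn m v ts
  firstReturn-cong u v u⇒v v⇒u [] = refl
  firstReturn-cong u v u⇒v v⇒u (t ∷ ts) with _≟v_ m (ρ^ m t u) u | _≟v_ m (ρ^ m t v) v
  ... | yes _ | yes _ = refl
  ... | yes u-fixed | no v-moves = ⊥-elim (v-moves (u⇒v t u-fixed))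
  ... | no u-moves | yes v-fixed = ⊥-elim (u-moves (v⇒u t v-fixed))
  ... | no _ | no _ = firstReturn-cong u v u⇒v v⇒u ts

  orbitSize-movingPart : ∀ {n} (v : Vec ℕ n) → orbitSize m v ≡ orbitSize m (movingPart v)
  orbitSize-movingPart {n} v = firstReturn-cong v (movingPart v) (λ t → movingPart-ρ^ t)
    (λ t e → ρ^-movingPart t refl e) (map suc (upTo (p n)))

  InOrbit⇒ : ∀ {n} {u v : Vec ℕ n} → InOrbit m u v → fixedPart u ≡ fixedPart v × InOrbit m (movingPart u) (movingPart v)
  InOrbit⇒ {u = u} {v} u∈orbit with t , e ← Any.satisfied u∈orbit =
    sym (fixedPart-ρ^ t e) ,
    subst (λ s → Any (λ t → ρ^ m t (movingPart v) ≡ movingPart u) (upTo s)) (orbitSize-movingPart v)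
          (Any.map (λ {t} → movingPart-ρ^ t) u∈orbit)

  ⇒InOrbit : ∀ {n} {u v : Vec ℕ n} → fixedPart u ≡ fixedPart v → InOrbit m (movingPart u) (movingPart v) → InOrbit m u v
  ⇒InOrbit {u = u} {v} fixed≡ moving∈orbit =
    Any.map (λ {t} → ρ^-movingPart t (sym fixed≡))
      (subst (λ s → Any (λ t → ρ^ m t (movingPart v) ≡ movingPart u) (upTo s)) (sym (orbitSize-movingPart v)) moving∈orbit)

  weight-split : ∀ {n} (v : Vec ℕ n) → weight v ≡ weight (movingPart v) + weight (fixedPart v)
  weight-split v = trans (cong weight (sym (movingPart⊕fixedPart v))) (weight-⊕ (movingPart v) (fixedPart v))

  weight-movingPart-≤ : ∀ {n} (v : Vec ℕ n) → weight (movingPart v) ≤ weight v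
  weight-movingPart-≤ v = subst (weight (movingPart v) ≤_) (sym (weight-split v)) (m≤m+n _ _)

  weight-fixedPart-≤ : ∀ {n} (v : Vec ℕ n) → weight (fixedPart v) ≤ weight v
  weight-fixedPart-≤ v = subst (weight (fixedPart v) ≤_) (sym (weight-split v)) (m≤n+m _ _)

  weight-movingPart-≡ : ∀ {n} {x y : Vec ℕ n} → weight x ≡ weight y → fixedPart x ≡ fixedPart y →
                        weight (movingPart x) ≡ weight (movingPart y)
  weight-movingPart-≡ {x = x} {y} wx≡wy fx≡fy = +-cancelʳ-≡ (weight (fixedPart y)) _ _ (begin
    weight (movingPart x) + weight (fixedPart y) ≡⟨ cong (λ z → weight (movingPart x) + weight z) fx≡fy ⟨
    weight (movingPart x) + weight (fixedPart x) ≡⟨ weight-split x ⟨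
    weight x                                     ≡⟨ wx≡wy ⟩
    weight y                                     ≡⟨ weight-split y ⟩
    weight (movingPart y) + weight (fixedPart y) ∎)
    where open ≡-Reasoning

  m∣weight-AllMoving : ∀ {n} (h : Vec ℕ n) → AllMoving h → m ∣ weight h
  m∣weight-AllMoving {n} h h-moving = ∣-sum-map (λ N → N * freq h N) (upTo (suc n)) (λ N _ →
    subst (λ z → m ∣ N * z)
          (trans (sym (freq-movingPart h N)) (cong (λ v → freq v N) (AllMoving⇒movingPart≡ h h-moving)))
      (m∣N*moving N (freq h N)))

module Representatives (m : ℕ) .{{_ : NonZero m}} where

  LexLeastInOrbit : ∀ {n} → List (Vec ℕ n) → Vec ℕ n → Set
  LexLeastInOrbit X x = ¬ Any (λ y → InOrbit m y x) (filter (_<lex? x) X)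

  lexLeastInOrbit? : ∀ {n} (X : List (Vec ℕ n)) x → Dec (LexLeastInOrbit X x)
  lexLeastInOrbit? X x = ¬? (Any.any? (λ y → inOrbit? m y x) (filter (_<lex? x) X))

  -- reps keeps the first element of each orbit met along the list; on a lex-sorted list it is the lex-least one.
  reps≡filter-lexLeast : ∀ {n} (X seen xs : List (Vec ℕ n)) → AllPairs _<lex_ xs → All (λ s → All (s <lex_) xs) seen →
                         seen ⊆ X → xs ⊆ X → (∀ {y} → y ∈ X → y ∈ seen ⊎ y ∈ xs) →
                         reps m seen xs ≡ filter (lexLeastInOrbit? X) xs
  reps≡filter-lexLeast X seen [] _ _ _ _ _ = refl
  reps≡filter-lexLeast X seen (x ∷ xs) (x<xs ∷ sorted) seen<xs seen⊆X xs⊆X X⊆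
    with reps≡filter-lexLeast X (x ∷ seen) xs sorted (x<xs ∷ All.map All.tail seen<xs)
           (λ { (here refl) → xs⊆X (here refl) ; (there y∈) → seen⊆X y∈ })
           (λ y∈ → xs⊆X (there y∈)) (λ y∈ → shift (X⊆ y∈))
       | Any.any? (λ y → inOrbit? m y x) seen
    where
    shift : ∀ {y} → y ∈ seen ⊎ y ∈ x ∷ xs → y ∈ x ∷ seen ⊎ y ∈ xs
    shift (inj₁ y∈) = inj₁ (there y∈)
    shift (inj₂ (here refl)) = inj₁ (here refl)
    shift (inj₂ (there y∈)) = inj₂ y∈
  ... | rec | yes seen∩orbit = trans rec (sym (filter-reject (lexLeastInOrbit? X) (λ least → least (smaller seen∩orbit))))
    where
    smaller : Any (λ y → InOrbit m y x) seen → Any (λ y → InOrbit m y x) (filter (_<lex? x) X)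
    smaller a with y , y∈ , y∈orbit ← find a =
      lose (∈-filter⁺ (_<lex? x) (seen⊆X y∈) (All.head (All.lookup seen<xs y∈))) y∈orbit
  ... | rec | no ¬seen∩orbit = trans (cong (x ∷_) rec) (sym (filter-accept (lexLeastInOrbit? X) least))
    where
    least : LexLeastInOrbit X x
    least a with y , y∈ , y∈orbit ← find a with y∈X , y<x ← ∈-filter⁻ (_<lex? x) y∈ with X⊆ y∈X
    ... | inj₁ y∈seen = ¬seen∩orbit (lose y∈seen y∈orbit)
    ... | inj₂ (here refl) = <lex-irrefl y<x
    ... | inj₂ (there y∈xs) = <lex-asym (All.lookup x<xs y∈xs) y<x

  reps≡filter : ∀ {n} (X : List (Vec ℕ n)) → AllPairs _<lex_ X → reps m [] X ≡ filter (lexLeastInOrbit? X) X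
  reps≡filter X sorted = reps≡filter-lexLeast X [] X sorted [] (λ ()) (λ y∈ → y∈) inj₂

-- Partitions of y are vectors of length y; resize carries them into the common length n ≥ y.
resize : ∀ {a b} → Vec ℕ a → Vec ℕ b
resize v = tabulate (λ i → freq v (suc (toℕ i)))

freq-resize : ∀ {a b} (u : Vec ℕ a) → weight u ≤ b → ∀ N → freq (resize {a} {b} u) N ≡ freq u N
freq-resize {a} {b} u w≤b zero = refl
freq-resize {a} {b} u w≤b (suc N) with suc N ≤? b
... | yes N≤b = trans (lookup∘tabulate _ (fromℕ< N≤b)) (cong (λ z → freq u (suc z)) (toℕ-fromℕ< N≤b))
... | no N≰b = sym (freq-beyond-weight u (suc N) (≤-<-trans w≤b (≰⇒> N≰b)))

weight-resize : ∀ {a b} (u : Vec ℕ a) → weight u ≤ b → weight (resize {a} {b} u) ≡ weight u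
weight-resize u w≤b = weight-cong _ u (freq-resize u w≤b)

_≟ᵥ_ : ∀ {n} → DecidableEquality (Vec ℕ n)
_≟ᵥ_ = ≡-dec _≟_

sorted⇒Unique : ∀ {n} {xs : List (Vec ℕ n)} → AllPairs _<lex_ xs → Unique xs
sorted⇒Unique = AllPairs.map <lex⇒≢

module Counting (m : ℕ) .{{_ : NonZero m}} (n : ℕ) where

  open Splitting m
  open Representatives m

  candidates : List (Vec ℕ n)
  candidates = vecs n n

  candidates-sorted : AllPairs _<lex_ candidates
  candidates-sorted = vecs-sorted n n

  Unique-filter-candidates : ∀ {P : Vec ℕ n → Set} (P? : ∀ v → Dec (P v)) → Unique (filter P? candidates)
  Unique-filter-candidates P? = sorted⇒Unique (AllPairs.filter⁺ P? candidates-sorted)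

  ofWeight : ℕ → List (Vec ℕ n)
  ofWeight y = filter (λ v → weight v ≟ y) candidates

  ∈-ofWeight⁻ : ∀ {y v} → v ∈ ofWeight y → weight v ≡ y
  ∈-ofWeight⁻ v∈ = proj₂ (∈-filter⁻ (λ v → weight v ≟ _) {xs = candidates} v∈)

  ∈-ofWeight⁺ : ∀ {y} v → weight v ≡ y → y ≤ n → v ∈ ofWeight y
  ∈-ofWeight⁺ v w≡y y≤n = ∈-filter⁺ _ (∈-vecs-weight n v (≤-trans (≤-reflexive w≡y) y≤n)) w≡y

  movingVecs : List (Vec ℕ n)
  movingVecs = filter (λ v → movingPart v ≟ᵥ v) candidates

  ∈-movingVecs⁻ : ∀ {h} → h ∈ movingVecs → movingPart h ≡ h
  ∈-movingVecs⁻ h∈ = proj₂ (∈-filter⁻ (λ v → movingPart v ≟ᵥ v) {xs = candidates} h∈)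

  movingPart∈movingVecs : ∀ v → weight v ≤ n → movingPart v ∈ movingVecs
  movingPart∈movingVecs v w≤n = ∈-filter⁺ _ (∈-vecs-weight n (movingPart v) (≤-trans (weight-movingPart-≤ v) w≤n))
    (AllMoving⇒movingPart≡ (movingPart v) (AllMoving-movingPart v))

  -- μ y counts the partitions of y into parts prime to m, each used fewer than m times.
  fixedOfWeight : ℕ → List (Vec ℕ n)
  fixedOfWeight y = filter (λ l → (fixedPart l ≟ᵥ l) ×-dec (weight l ≟ y)) candidates

  μ : ℕ → ℕ
  μ y = length (fixedOfWeight y)

  fibreOfWeight : ℕ → Vec ℕ n → List (Vec ℕ n)
  fibreOfWeight y = fibre _≟ᵥ_ movingPart (ofWeight y)

  length-fibreOfWeight : ∀ y h → movingPart h ≡ h → weight h ≤ y → y ≤ n →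
                         length (fibreOfWeight y h) ≡ μ (y ∸ weight h)
  length-fibreOfWeight y h h-moving w≤y y≤n =
    length-≡-inverse fixedPart (h ⊕_) (fibreOfWeight y h) (fixedOfWeight (y ∸ weight h))
      (Unique.filter⁺ _ (Unique-filter-candidates _)) (Unique-filter-candidates _)
      fixedPart∈ h⊕∈ h⊕fixedPart fixedPart-h⊕
    where
    AllMoving-h : AllMoving h
    AllMoving-h = movingPart≡⇒AllMoving h h-moving
    ∈-fibre⁻ : ∀ {x} → x ∈ fibreOfWeight y h → weight x ≡ y × movingPart x ≡ h
    ∈-fibre⁻ x∈ with x∈ofWeight , x↦h ← ∈-filter⁻ (λ x → movingPart x ≟ᵥ h) {xs = ofWeight y} x∈ =
      ∈-ofWeight⁻ x∈ofWeight , x↦h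
    ∈-fixedOfWeight⁻ : ∀ {l} → l ∈ fixedOfWeight (y ∸ weight h) → fixedPart l ≡ l × weight l ≡ y ∸ weight h
    ∈-fixedOfWeight⁻ l∈ =
      proj₂ (∈-filter⁻ (λ l → (fixedPart l ≟ᵥ l) ×-dec (weight l ≟ y ∸ weight h)) {xs = candidates} l∈)
    fixedPart∈ : ∀ x → x ∈ fibreOfWeight y h → fixedPart x ∈ fixedOfWeight (y ∸ weight h)
    fixedPart∈ x x∈ with wx , x↦h ← ∈-fibre⁻ x∈ =
      ∈-filter⁺ _ (∈-vecs-weight n (fixedPart x) (≤-trans (weight-fixedPart-≤ x) (≤-trans (≤-reflexive wx) y≤n)))
        (AllFixed⇒fixedPart≡ (fixedPart x) (AllFixed-fixedPart x) , weight-fixed)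
      where
      weight-fixed : weight (fixedPart x) ≡ y ∸ weight h
      weight-fixed = begin
        weight (fixedPart x)
          ≡⟨ m+n∸m≡n (weight (movingPart x)) _ ⟨
        weight (movingPart x) + weight (fixedPart x) ∸ weight (movingPart x)
          ≡⟨ cong₂ _∸_ (trans (sym (weight-split x)) wx) (cong weight x↦h) ⟩
        y ∸ weight h ∎
        where open ≡-Reasoning
    h⊕∈ : ∀ l → l ∈ fixedOfWeight (y ∸ weight h) → h ⊕ l ∈ fibreOfWeight y h
    h⊕∈ l l∈ with l-fixed , wl ← ∈-fixedOfWeight⁻ l∈ =
      ∈-filter⁺ _ (∈-ofWeight⁺ (h ⊕ l) weight-h⊕l y≤n)
        (proj₁ (split-⊕ h l AllMoving-h (fixedPart≡⇒AllFixed l l-fixed)))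
      where
      weight-h⊕l : weight (h ⊕ l) ≡ y
      weight-h⊕l = trans (weight-⊕ h l) (trans (cong (weight h +_) wl) (m+[n∸m]≡n w≤y))
    h⊕fixedPart : ∀ x → x ∈ fibreOfWeight y h → h ⊕ fixedPart x ≡ x
    h⊕fixedPart x x∈ = trans (cong (_⊕ fixedPart x) (sym (proj₂ (∈-fibre⁻ x∈)))) (movingPart⊕fixedPart x)
    fixedPart-h⊕ : ∀ l → l ∈ fixedOfWeight (y ∸ weight h) → fixedPart (h ⊕ l) ≡ l
    fixedPart-h⊕ l l∈ = proj₂ (split-⊕ h l AllMoving-h (fixedPart≡⇒AllFixed l (proj₁ (∈-fixedOfWeight⁻ l∈))))

  length-fibreOfWeight-> : ∀ y h → y < weight h → length (fibreOfWeight y h) ≡ 0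
  length-fibreOfWeight-> y h y<w = length-filter-none (λ x → movingPart x ≟ᵥ h) (ofWeight y) (λ x x∈ x↦h →
    <⇒≱ y<w (subst (_≤ y) (cong weight x↦h)
              (subst (weight (movingPart x) ≤_) (∈-ofWeight⁻ x∈) (weight-movingPart-≤ x))))

  p≡length-ofWeight : ∀ y → y ≤ n → p y ≡ length (ofWeight y)
  p≡length-ofWeight y y≤n = length-≡-inverse resize resize (partitions y) (ofWeight y)
    (sorted⇒Unique (AllPairs.filter⁺ _ (vecs-sorted y y))) (Unique-filter-candidates _)
    (λ x x∈ → ∈-ofWeight⁺ (resize x) (weight-resize↑ x∈) y≤n)
    (λ u u∈ → ∈-filter⁺ _ (∈-vecs-weight y (resize u) (≤-reflexive (weight-resize↓ u∈))) (weight-resize↓ u∈))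
    (λ x x∈ → freq-ext (λ N → trans (freq-resize {b = y} (resize {b = n} x) (≤-reflexive (weight-resize↑ x∈)) N)
                                     (freq-resize {b = n} x (≤-trans (≤-reflexive (wx x∈)) y≤n) N)))
    (λ u u∈ → freq-ext (λ N → trans (freq-resize {b = n} (resize {b = y} u)
                                                   (≤-trans (≤-reflexive (weight-resize↓ u∈)) y≤n) N)
                                     (freq-resize {b = y} u (≤-reflexive (∈-ofWeight⁻ u∈)) N)))
    where
    wx : ∀ {x} → x ∈ partitions y → weight x ≡ y
    wx x∈ = proj₂ (∈-filter⁻ (λ v → weight v ≟ y) {xs = vecs y y} x∈)
    weight-resize↑ : ∀ {x} → x ∈ partitions y → weight (resize {y} {n} x) ≡ y
    weight-resize↑ {x} x∈ = trans (weight-resize {b = n} x (≤-trans (≤-reflexive (wx x∈)) y≤n)) (wx x∈)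
    weight-resize↓ : ∀ {u} → u ∈ ofWeight y → weight (resize {n} {y} u) ≡ y
    weight-resize↓ {u} u∈ = trans (weight-resize {b = y} u (≤-reflexive (∈-ofWeight⁻ u∈))) (∈-ofWeight⁻ u∈)

  p≡sum-fibres : ∀ y → y ≤ n → p y ≡ sum (map (length ∘ fibreOfWeight y) movingVecs)
  p≡sum-fibres y y≤n = trans (p≡length-ofWeight y y≤n)
    (length-≡-sum-fibres _≟ᵥ_ movingPart (ofWeight y) movingVecs (Unique-filter-candidates _)
      (λ x x∈ → movingPart∈movingVecs x (≤-trans (≤-reflexive (∈-ofWeight⁻ x∈)) y≤n)))

  movingRivals : Vec ℕ n → List (Vec ℕ n)
  movingRivals h = filter (λ y → ((movingPart y ≟ᵥ y) ×-dec (weight y ≟ weight h)) ×-dec (y <lex? h)) candidates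

  ∈-movingRivals⁻ : ∀ {y h} → y ∈ movingRivals h → (movingPart y ≡ y × weight y ≡ weight h) × y <lex h
  ∈-movingRivals⁻ {h = h} y∈ =
    proj₂ (∈-filter⁻ (λ y → ((movingPart y ≟ᵥ y) ×-dec (weight y ≟ weight h)) ×-dec (y <lex? h))
                     {xs = candidates} y∈)

  LexLeastMoving : Vec ℕ n → Set
  LexLeastMoving h = ¬ Any (λ y → InOrbit m y h) (movingRivals h)

  lexLeastMoving? : ∀ h → Dec (LexLeastMoving h)
  lexLeastMoving? h = ¬? (Any.any? (λ y → inOrbit? m y h) (movingRivals h))

  -- y ↦ movingPart y and y′ ↦ y′ ⊕ fixedPart x match the lex-smaller elements of the orbit of x with
  -- those of the orbit of movingPart x.
  rival-movingPart : ∀ {x} → x ∈ ofWeight n → Any (λ y → InOrbit m y x) (filter (_<lex? x) (ofWeight n)) →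
                     Any (λ y → InOrbit m y (movingPart x)) (movingRivals (movingPart x))
  rival-movingPart {x} x∈ a with y , y∈ , y∈orbit ← find a with y∈X , y<x ← ∈-filter⁻ (_<lex? x) {xs = ofWeight n} y∈
                               with fy≡fx , my∈orbit ← InOrbit⇒ y∈orbit =
    lose (∈-filter⁺ _ (∈-vecs-weight n (movingPart y)
                                     (≤-trans (weight-movingPart-≤ y) (≤-reflexive (∈-ofWeight⁻ y∈X))))
                      ((AllMoving⇒movingPart≡ (movingPart y) (AllMoving-movingPart y) ,
                        weight-movingPart-≡ (trans (∈-ofWeight⁻ y∈X) (sym (∈-ofWeight⁻ x∈))) fy≡fx) ,
                       my<mx))
         my∈orbit
    where
    my<mx : movingPart y <lex movingPart x
    my<mx = +-cancelʳ-<lex (movingPart y) (movingPart x) (fixedPart x)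
      (subst₂ _<lex_ (trans (sym (movingPart⊕fixedPart y)) (cong (movingPart y ⊕_) fy≡fx))
                     (sym (movingPart⊕fixedPart x)) y<x)

  movingPart-rival : ∀ {x} → x ∈ ofWeight n → Any (λ y → InOrbit m y (movingPart x)) (movingRivals (movingPart x)) →
                     Any (λ y → InOrbit m y x) (filter (_<lex? x) (ofWeight n))
  movingPart-rival {x} x∈ a with y′ , y′∈ , y′∈orbit ← find a
                            with (y′-moving , wy′) , y′<mx ← ∈-movingRivals⁻ y′∈ =
    lose (∈-filter⁺ (_<lex? x) (∈-ofWeight⁺ y weight-y ≤-refl) y<x)
         (⇒InOrbit (proj₂ parts) (subst (λ z → InOrbit m z (movingPart x)) (sym (proj₁ parts)) y′∈orbit))
    where
    y = y′ ⊕ fixedPart x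
    parts = split-⊕ y′ (fixedPart x) (movingPart≡⇒AllMoving y′ y′-moving) (AllFixed-fixedPart x)
    weight-y : weight y ≡ n
    weight-y = trans (weight-⊕ y′ (fixedPart x))
                     (trans (cong (_+ weight (fixedPart x)) wy′) (trans (sym (weight-split x)) (∈-ofWeight⁻ x∈)))
    y<x : y <lex x
    y<x = subst (y <lex_) (movingPart⊕fixedPart x) (+-monoˡ-<lex (fixedPart x) y′<mx)

  leastInOrbit : List (Vec ℕ n)
  leastInOrbit = filter (lexLeastInOrbit? (ofWeight n)) (ofWeight n)

  orbitReps : ℕ → List (Vec ℕ n)
  orbitReps k = filter (λ v → orbitSize m v ≟ k) leastInOrbit

  o≡length-orbitReps : ∀ k → o m n k ≡ length (orbitReps k)
  o≡length-orbitReps k = cong (λ xs → length (filter (λ v → orbitSize m v ≟ k) xs))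
    (reps≡filter (ofWeight n) (AllPairs.filter⁺ _ candidates-sorted))

  ∈-orbitReps⁻ : ∀ {k x} → x ∈ orbitReps k →
                 x ∈ ofWeight n × orbitSize m (movingPart x) ≡ k × LexLeastMoving (movingPart x)
  ∈-orbitReps⁻ {k} {x} x∈ with x∈least , size≡k ← ∈-filter⁻ (λ v → orbitSize m v ≟ k) {xs = leastInOrbit} x∈
                           with x∈X , least ← ∈-filter⁻ (lexLeastInOrbit? (ofWeight n)) {xs = ofWeight n} x∈least =
    x∈X , trans (sym (orbitSize-movingPart x)) size≡k , λ a → least (movingPart-rival x∈X a)

  fibre-orbitReps : ∀ k h → orbitSize m h ≡ k → LexLeastMoving h →
                    fibre _≟ᵥ_ movingPart (orbitReps k) h ≡ fibreOfWeight n h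
  fibre-orbitReps k h size≡k least =
    trans (filter-filter-⇒ (λ x → movingPart x ≟ᵥ h) (λ v → orbitSize m v ≟ k) leastInOrbit
            (λ x _ x↦h → trans (orbitSize-movingPart x) (trans (cong (orbitSize m) x↦h) size≡k)))
          (filter-filter-⇒ (λ x → movingPart x ≟ᵥ h) (lexLeastInOrbit? (ofWeight n)) (ofWeight n)
            (λ x x∈ x↦h a → least (subst LexLeastMoving′ x↦h (rival-movingPart x∈ a))))
    where
    LexLeastMoving′ : Vec ℕ n → Set
    LexLeastMoving′ z = Any (λ y → InOrbit m y z) (movingRivals z)

  length-fibre-orbitReps : ∀ k h → ¬ (orbitSize m h ≡ k × LexLeastMoving h) →
                           length (fibre _≟ᵥ_ movingPart (orbitReps k) h) ≡ 0
  length-fibre-orbitReps k h ¬rep = length-filter-none (λ x → movingPart x ≟ᵥ h) (orbitReps k)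
    (λ x x∈ x↦h → ¬rep (subst (λ z → orbitSize m z ≡ k × LexLeastMoving z) x↦h (proj₂ (∈-orbitReps⁻ x∈))))

  o≡sum-fibres : ∀ k → o m n k ≡ sum (map (length ∘ fibre _≟ᵥ_ movingPart (orbitReps k)) movingVecs)
  o≡sum-fibres k = trans (o≡length-orbitReps k)
    (length-≡-sum-fibres _≟ᵥ_ movingPart (orbitReps k) movingVecs (Unique-filter-candidates _)
      (λ x x∈ → movingPart∈movingVecs x (≤-reflexive (∈-ofWeight⁻ (proj₁ (∈-orbitReps⁻ x∈))))))

  module _ (A B C : ℕ) (B<A : B < A) (A∣m : A ∣ m) (p-div : ∀ q → C ∣ p (A * q + B)) where

    ∸-weight-moving : ∀ y q (h : Vec ℕ n) → movingPart h ≡ h → weight h ≤ y → y ≡ A * q + B →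
                      ∃ λ q′ → y ∸ weight h ≡ A * q′ + B
    ∸-weight-moving y q h h-moving w≤y refl
      with divides s w≡s*A ← ∣-trans A∣m (m∣weight-AllMoving h (movingPart≡⇒AllMoving h h-moving)) =
      q ∸ s , trans (cong (A * q + B ∸_) w≡A*s) ([a*q+b]∸a*s≡a*[q∸s]+b A q B s B<A (subst (_≤ A * q + B) w≡A*s w≤y))
      where w≡A*s = trans w≡s*A (*-comm s A)

    C∣length-fibreOfWeight : ∀ y q (h : Vec ℕ n) → movingPart h ≡ h → y ≤ n → y ≡ A * q + B →
                             (∀ q′ → weight h ≤ y → y ∸ weight h ≡ A * q′ + B → C ∣ μ (y ∸ weight h)) →
                             C ∣ length (fibreOfWeight y h)
    C∣length-fibreOfWeight y q h h-moving y≤n y≡ C∣μ′ with weight h ≤? y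
    ... | no w≰y = subst (C ∣_) (sym (length-fibreOfWeight-> y h (≰⇒> w≰y))) (C ∣0)
    ... | yes w≤y with q′ , y∸w≡ ← ∸-weight-moving y q h h-moving w≤y y≡ =
      subst (C ∣_) (sym (length-fibreOfWeight y h h-moving w≤y y≤n)) (C∣μ′ q′ w≤y y∸w≡)

    C∣μ : ∀ y q → y ≤ n → y ≡ A * q + B → C ∣ μ y
    C∣μ = <-rec (λ y → ∀ q → y ≤ n → y ≡ A * q + B → C ∣ μ y) step
      where
      0ᵥ = replicate n 0
      step : ∀ y → (∀ {y′} → y′ < y → ∀ q → y′ ≤ n → y′ ≡ A * q + B → C ∣ μ y′) →
             ∀ q → y ≤ n → y ≡ A * q + B → C ∣ μ y
      step y rec q y≤n y≡ =
        subst (C ∣_) (trans (length-fibreOfWeight y 0ᵥ 0ᵥ-moving w0≤y y≤n) (cong (μ ∘ (y ∸_)) (weight-replicate-0 n)))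
        (∣-sum-map⇒∣ (length ∘ fibreOfWeight y) (Unique-filter-candidates _) 0ᵥ∈movingVecs others
          (subst (C ∣_) (trans (cong p (sym y≡)) (p≡sum-fibres y y≤n)) (p-div q)))
        where
        0ᵥ-moving : movingPart 0ᵥ ≡ 0ᵥ
        0ᵥ-moving = AllMoving⇒movingPart≡ 0ᵥ (λ i → trans (cong (fixed _) (lookup-replicate i 0)) (fixed-zero _))
        w0≤y : weight 0ᵥ ≤ y
        w0≤y = subst (_≤ y) (sym (weight-replicate-0 n)) z≤n
        0ᵥ∈movingVecs : 0ᵥ ∈ movingVecs
        0ᵥ∈movingVecs = ∈-filter⁺ _ (∈-vecs-weight n 0ᵥ (≤-trans w0≤y y≤n)) 0ᵥ-moving
        others : ∀ h → h ∈ movingVecs → h ≢ 0ᵥ → C ∣ length (fibreOfWeight y h)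
        others h h∈ h≢0 = C∣length-fibreOfWeight y q h (∈-movingVecs⁻ h∈) y≤n y≡ (λ q′ w≤y y∸w≡ →
          rec (∸-monoʳ-< {o = 0} (n≢0⇒n>0 (h≢0 ∘ weight≡0⇒≡replicate h)) w≤y) q′
              (≤-trans (m∸n≤m y (weight h)) y≤n) y∸w≡)

    C∣o : ∀ n₀ → n ≡ A * n₀ + B → ∀ k → C ∣ o m n k
    C∣o n₀ n≡ k = subst (C ∣_) (sym (o≡sum-fibres k)) (∣-sum-map _ movingVecs C∣fibre)
      where
      C∣fibre : ∀ h → h ∈ movingVecs → C ∣ length (fibre _≟ᵥ_ movingPart (orbitReps k) h)
      C∣fibre h h∈ with orbitSize m h ≟ k | lexLeastMoving? h
      ... | yes size≡k | yes least = subst (C ∣_) (cong length (sym (fibre-orbitReps k h size≡k least)))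
        (C∣length-fibreOfWeight n n₀ h (∈-movingVecs⁻ h∈) ≤-refl n≡
          (λ q′ _ e → C∣μ (n ∸ weight h) q′ (m∸n≤m n (weight h)) e))
      ... | no size≢k | _ = subst (C ∣_) (sym (length-fibre-orbitReps k h (size≢k ∘ proj₁))) (C ∣0)
      ... | yes _ | no ¬least = subst (C ∣_) (sym (length-fibre-orbitReps k h (¬least ∘ proj₂))) (C ∣0)

theorem2 : (m : ℕ) .{{_ : NonZero m}} → 2 ≤ m →
    (A B C : ℕ) → 1 ≤ A → 1 ≤ C → B < A →
    ((n : ℕ) → C ∣ p (A * n + B)) →
    A ∣ m →
    (n k : ℕ) → 1 ≤ k → C ∣ o m (A * n + B) k
theorem2 m _ A B C _ _ B<A p-div A∣m n k _ = Counting.C∣o m (A * n + B) A B C B<A A∣m p-div n refl k
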